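{- Let $G=(V,E)$ be a finite simple graph of order $n$ and $\bar{G}$ its complement. Then \[ D(G,x)+N(\bar{G},x)=(1+x)^n. \]
   Context: For $W\subseteq V$, $N_G[W]=W\cup\bigcup_{w\in W}N_G(w)$, where $N_G(w)$ is the set of vertices adjacent to $w$. A dominating set of $G$ is a set $W\subseteq V$ with $N_G[W]=V$; the domination polynomial is $D(G,x)=\sum_{W \text{ dominating}}x^{|W|}$. For a graph $H$ on $V$, the neighborhood complex is $\mathcal{N}(H)=\{X\subseteq V\mid \exists v\in V: X\subseteq N_H(v)\}$ and the neighborhood polynomial is $N(H,x)=\sum_{W\in\mathcal{N}(H)}x^{|W|}$. -}

module Defs where

open import Data.Nat using (ℕ; zero; suc)
open import Data.Bool using (Bool; true; false)
open import Data.Fin using (Fin)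
open import Data.Fin.Subset using (Subset; _∈_; _⊆_; ∣_∣; outside; inside)
open import Data.Fin.Subset.Properties using (_∈?_)
open import Data.Vec using (Vec; []; _∷_)
open import Data.List using (List; []; _∷_; map; _++_; length; filter)
open import Data.Product using (Σ; ∃; _×_; _,_)
open import Data.Sum using (_⊎_)
open import Relation.Binary.PropositionalEquality using (_≡_; _≢_)
open import Relation.Nullary using (Dec; yes; no; ¬_)
open import Relation.Nullary.Decidable using (_×-dec_; _⊎-dec_)
open import Data.Fin.Properties using (any?; all?)

record Graph (n : ℕ) : Set where
  field
    adj    : Fin n → Fin n → Bool
    adj-sym    : ∀ u v → adj u v ≡ adj v u
    adj-irrefl : ∀ v → adj v v ≡ false

open Graph public

Adj : ∀ {n} → Graph n → Fin n → Fin n → Set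
Adj G u v = adj G u v ≡ true

complement : ∀ {n} → Graph n → Graph n
complement {n} G = record { adj = cadj ; adj-sym = csym ; adj-irrefl = cirr }
  where
  open import Data.Fin using (_≟_)
  open import Data.Bool using (not; _∧_)
  open import Relation.Nullary.Decidable using (⌊_⌋)
  open import Relation.Binary.PropositionalEquality using (refl; cong; sym)
  cadj : Fin n → Fin n → Bool
  cadj u v = not ⌊ u ≟ v ⌋ ∧ not (adj G u v)
  csym : ∀ u v → cadj u v ≡ cadj v u
  csym u v with u ≟ v | v ≟ u
  ... | yes _ | yes _ = refl
  ... | no _  | no _  = cong not (adj-sym G u v)
  ... | yes p | no q  = Data.Empty.⊥-elim (q (sym p)) where import Data.Empty
  ... | no p  | yes q = Data.Empty.⊥-elim (p (sym q)) where import Data.Empty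
  cirr : ∀ v → cadj v v ≡ false
  cirr v with v ≟ v
  ... | yes _ = refl
  ... | no p  = Data.Empty.⊥-elim (p refl) where import Data.Empty

InClosedNbhd : ∀ {n} → Graph n → Subset n → Fin n → Set
InClosedNbhd G W v = v ∈ W ⊎ ∃ λ w → w ∈ W × Adj G w v

Dominating : ∀ {n} → Graph n → Subset n → Set
Dominating G W = ∀ v → InClosedNbhd G W v

SubsetOfNbhd : ∀ {n} → Graph n → Subset n → Fin n → Set
SubsetOfNbhd H X v = ∀ u → u ∈ X → Adj H v u

InNbhdComplex : ∀ {n} → Graph n → Subset n → Set
InNbhdComplex H X = ∃ λ v → SubsetOfNbhd H X v

private
  open import Data.Bool using () renaming (_≟_ to _≟B_)
  adj? : ∀ {n} (G : Graph n) u v → Dec (Adj G u v)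
  adj? G u v = adj G u v ≟B true

  imp? : ∀ {A B : Set} → Dec A → Dec B → Dec (A → B)
  imp? (yes a) (yes b) = yes (λ _ → b)
  imp? (yes a) (no nb) = no (λ f → nb (f a))
  imp? (no na) _       = yes (λ a → Data.Empty.⊥-elim (na a)) where import Data.Empty

dominating? : ∀ {n} (G : Graph n) (W : Subset n) → Dec (Dominating G W)
dominating? G W = all? λ v → (v ∈? W) ⊎-dec any? (λ w → (w ∈? W) ×-dec adj? G w v)

inNbhdComplex? : ∀ {n} (H : Graph n) (X : Subset n) → Dec (InNbhdComplex H X)
inNbhdComplex? H X = any? λ v → all? λ u → imp? (u ∈? X) (adj? H v u)

allSubsets : ∀ n → List (Subset n)
allSubsets zero = [] ∷ []
allSubsets (suc n) = map (outside ∷_) (allSubsets n) ++ map (inside ∷_) (allSubsets n)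

ofSize : ∀ {n} → ℕ → Subset n → Set
ofSize k W = ∣ W ∣ ≡ k

-- coefficient of x^k in D(G,x): number of dominating sets of size k
domCoeff : ∀ {n} → Graph n → ℕ → ℕ
domCoeff {n} G k = length (filter (λ W → dominating? G W ×-dec (∣ W ∣ Data.Nat.≟ k)) (allSubsets n))
  where import Data.Nat

-- coefficient of x^k in N(H,x): number of sets of size k in the neighbourhood complex
nbhdCoeff : ∀ {n} → Graph n → ℕ → ℕ
nbhdCoeff {n} H k = length (filter (λ X → inNbhdComplex? H X ×-dec (∣ X ∣ Data.Nat.≟ k)) (allSubsets n))
  where import Data.Nat

module Submission where

-- The key observation (Lemma "undominated vertices") is that for a vertex
-- set W and a vertex v of G,
--     v ∉ N_G[W]   ⇔   W ⊆ N_Ḡ(v),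
-- because in the complement v is adjacent exactly to the vertices that are
-- different from v and not G-adjacent to it.  Hence W lies in the
-- neighbourhood complex of Ḡ iff some vertex is undominated by W, i.e.
-- iff W is NOT a dominating set of G.  So among the subsets of size k the
-- dominating sets of G and the faces of 𝒩(Ḡ) are complementary, and their
-- numbers add up to the number of all k-subsets of an n-set, which is
-- n C k.

open import Defs
open import Data.Bool using (true; false) renaming (_≟_ to _≟ᵇ_)
open import Data.Empty using (⊥-elim)
open import Data.Fin using (Fin; _≟_)
open import Data.Fin.Properties using (any?; ¬∀⟶∃¬)
open import Data.Fin.Subset using (Subset; _∈_; ∣_∣; outside; inside)
open import Data.Fin.Subset.Properties using (_∈?_)
open import Data.List using (List; []; _∷_; _++_; map; length; filter)
open import Data.List.Properties using (length-++; filter-++; filter-none)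
import Data.List.Relation.Unary.All as All
open import Data.Nat using (ℕ; zero; suc; _+_)
import Data.Nat as ℕ
open import Data.Nat.Combinatorics using (_C_; nCk+nC[k+1]≡[n+1]C[k+1])
open import Data.Nat.Properties using (+-suc; +-comm; +-identityʳ)
open import Data.Product using (_×_; _,_)
open import Data.Sum using (inj₁; inj₂)
open import Data.Vec using (_∷_)
open import Relation.Binary.PropositionalEquality
  using (_≡_; _≢_; refl; sym; trans; cong; cong₂; subst; module ≡-Reasoning)
open import Relation.Nullary using (Dec; yes; no; ¬_; does)
open import Relation.Nullary.Decidable using (_×-dec_; _⊎-dec_)
open import Relation.Unary using (Pred; Decidable)
open import Level using (Level)

private
  variable
    p q r : Level

-- 'filter' only inspects the boolean part of a decision, so two deciders
-- with the same verdicts filter identically.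
filter-does-cong : ∀ {A : Set} {P : Pred A p} {Q : Pred A q} (P? : Decidable P) (Q? : Decidable Q) →
  (∀ x → does (P? x) ≡ does (Q? x)) → ∀ xs → filter P? xs ≡ filter Q? xs
filter-does-cong P? Q? same [] = refl
filter-does-cong P? Q? same (x ∷ xs) with does (P? x) | does (Q? x) | same x
... | true  | .true  | refl = cong (x ∷_) (filter-does-cong P? Q? same xs)
... | false | .false | refl = filter-does-cong P? Q? same xs

length-filter-map : ∀ {A B : Set} {P : Pred B p} (P? : Decidable P) (f : A → B) xs →
  length (filter P? (map f xs)) ≡ length (filter (λ x → P? (f x)) xs)
length-filter-map P? f [] = refl
length-filter-map P? f (x ∷ xs) with does (P? (f x))
... | true  = cong suc (length-filter-map P? f xs)
... | false = length-filter-map P? f xs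

length-filter-complementary : ∀ {A : Set} {P : Pred A p} {Q : Pred A q} {R : Pred A r}
  (P? : Decidable P) (Q? : Decidable Q) (R? : Decidable R) →
  (∀ {x} → P x → ¬ Q x) → (∀ {x} → ¬ P x → Q x) → ∀ xs →
  length (filter (λ x → P? x ×-dec R? x) xs) + length (filter (λ x → Q? x ×-dec R? x) xs)
    ≡ length (filter R? xs)
length-filter-complementary P? Q? R? disjoint cover [] = refl
length-filter-complementary P? Q? R? disjoint cover (x ∷ xs)
  with P? x | Q? x | R? x | length-filter-complementary P? Q? R? disjoint cover xs
... | yes p  | yes q  | _     | _  = ⊥-elim (disjoint p q)
... | no ¬p  | no ¬q  | _     | _  = ⊥-elim (¬q (cover ¬p))
... | yes _  | no _   | yes _ | ih = cong suc ih
... | no _   | yes _  | yes _ | ih = trans (+-suc _ _) (cong suc ih)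
... | yes _  | no _   | no _  | ih = ih
... | no _   | yes _  | no _  | ih = ih

kSubsets : ∀ n → ℕ → List (Subset n)
kSubsets n k = filter (λ W → ∣ W ∣ ℕ.≟ k) (allSubsets n)

-- Pascal's rule on the level of subsets: a k-subset of {0,…,n} either
-- omits 0 (a k-subset of the rest) or contains it (a (k-1)-subset of the rest).
length-kSubsets : ∀ n k → length (kSubsets n k) ≡ n C k
length-kSubsets zero zero    = refl
length-kSubsets zero (suc k) = refl
length-kSubsets (suc n) k = begin
  length (kSubsets (suc n) k)
    ≡⟨ cong length (filter-++ size? (map (outside ∷_) subsets) (map (inside ∷_) subsets)) ⟩
  length (filter size? (map (outside ∷_) subsets) ++ filter size? (map (inside ∷_) subsets))
    ≡⟨ length-++ (filter size? (map (outside ∷_) subsets)) ⟩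
  length (filter size? (map (outside ∷_) subsets)) + length (filter size? (map (inside ∷_) subsets))
    ≡⟨ cong₂ _+_ (length-filter-map size? (outside ∷_) subsets)
                 (length-filter-map size? (inside ∷_) subsets) ⟩
  length (kSubsets n k) + length (filter (λ W → size? (inside ∷ W)) subsets)
    ≡⟨ pascal k ⟩
  suc n C k ∎
  where
  open ≡-Reasoning
  subsets : List (Subset n)
  subsets = allSubsets n
  size? : (W : Subset (suc n)) → Dec (∣ W ∣ ≡ k)
  size? W = ∣ W ∣ ℕ.≟ k
  pascal : ∀ k → length (kSubsets n k) + length (filter (λ W → suc ∣ W ∣ ℕ.≟ k) subsets) ≡ suc n C k
  pascal zero = begin
    length (kSubsets n 0) + length (filter (λ W → suc ∣ W ∣ ℕ.≟ 0) subsets)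
      ≡⟨ cong (λ xs → length (kSubsets n 0) + length xs) (filter-none _ (All.universal (λ _ ()) subsets)) ⟩
    length (kSubsets n 0) + 0
      ≡⟨ +-identityʳ _ ⟩
    length (kSubsets n 0)
      ≡⟨ length-kSubsets n 0 ⟩
    1 ∎
  pascal (suc k) = begin
    length (kSubsets n (suc k)) + length (filter (λ W → suc ∣ W ∣ ℕ.≟ suc k) subsets)
      ≡⟨ cong (length (kSubsets n (suc k)) +_)
              (cong length (filter-does-cong _ (λ W → ∣ W ∣ ℕ.≟ k) (λ _ → refl) subsets)) ⟩
    length (kSubsets n (suc k)) + length (kSubsets n k)
      ≡⟨ cong₂ _+_ (length-kSubsets n (suc k)) (length-kSubsets n k) ⟩
    n C suc k + n C k
      ≡⟨ +-comm (n C suc k) (n C k) ⟩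
    n C k + n C suc k
      ≡⟨ nCk+nC[k+1]≡[n+1]C[k+1] n k ⟩
    suc n C suc k ∎

complement-adj⇒ : ∀ {n} (G : Graph n) {v u : Fin n} →
  Adj (complement G) v u → v ≢ u × ¬ Adj G v u
complement-adj⇒ G {v} {u} vu with v ≟ u | adj G v u
... | no v≢u | false = v≢u , λ ()
... | yes _  | _     with () ← vu
... | no _   | true  with () ← vu

complement-adj⇐ : ∀ {n} (G : Graph n) {v u : Fin n} →
  v ≢ u → ¬ Adj G v u → Adj (complement G) v u
complement-adj⇐ G {v} {u} v≢u ¬vu with v ≟ u | adj G v u
... | yes v≡u | _     = ⊥-elim (v≢u v≡u)
... | no _    | false = refl
... | no _    | true  = ⊥-elim (¬vu refl)

undominated⇒covers : ∀ {n} (G : Graph n) (W : Subset n) (v : Fin n) →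
  ¬ InClosedNbhd G W v → SubsetOfNbhd (complement G) W v
undominated⇒covers G W v undominated u u∈W =
  complement-adj⇐ G v≢u (λ vu → undominated (inj₂ (u , u∈W , trans (adj-sym G u v) vu)))
  where
  v≢u : v ≢ u
  v≢u v≡u = undominated (inj₁ (subst (_∈ W) (sym v≡u) u∈W))

covers⇒undominated : ∀ {n} (G : Graph n) (W : Subset n) (v : Fin n) →
  SubsetOfNbhd (complement G) W v → ¬ InClosedNbhd G W v
covers⇒undominated G W v covers (inj₁ v∈W) =
  let v≢v , _ = complement-adj⇒ G (covers v v∈W) in v≢v refl
covers⇒undominated G W v covers (inj₂ (w , w∈W , wv)) =
  let _ , ¬vw = complement-adj⇒ G (covers w w∈W) in ¬vw (trans (adj-sym G v w) wv)

inClosedNbhd? : ∀ {n} (G : Graph n) (W : Subset n) (v : Fin n) → Dec (InClosedNbhd G W v)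
inClosedNbhd? G W v = (v ∈? W) ⊎-dec any? (λ w → (w ∈? W) ×-dec (adj G w v ≟ᵇ true))

dominating⇒¬inNbhdComplex : ∀ {n} (G : Graph n) {W : Subset n} →
  Dominating G W → ¬ InNbhdComplex (complement G) W
dominating⇒¬inNbhdComplex G {W} dominating (v , covers) =
  covers⇒undominated G W v covers (dominating v)

¬dominating⇒inNbhdComplex : ∀ {n} (G : Graph n) {W : Subset n} →
  ¬ Dominating G W → InNbhdComplex (complement G) W
¬dominating⇒inNbhdComplex G {W} ¬dominating =
  let v , undominated = ¬∀⟶∃¬ _ _ (inClosedNbhd? G W) ¬dominating
  in v , undominated⇒covers G W v undominated

mainTheorem8 : ∀ (n : ℕ) (G : Graph n) (k : ℕ) →
    domCoeff G k + nbhdCoeff (complement G) k ≡ n C k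
mainTheorem8 n G k = begin
  domCoeff G k + nbhdCoeff (complement G) k
    ≡⟨ length-filter-complementary (dominating? G) (inNbhdComplex? (complement G))
         (λ W → ∣ W ∣ ℕ.≟ k) (dominating⇒¬inNbhdComplex G) (¬dominating⇒inNbhdComplex G)
         (allSubsets n) ⟩
  length (kSubsets n k)
    ≡⟨ length-kSubsets n k ⟩
  n C k ∎
  where open ≡-Reasoning
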